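{- Let $\mathcal{G}$ be a rooted temporal tree in which every edge is associated with exactly one time interval, and let $v$ be a non-leaf node with children $u_1,\dots,u_k$. Suppose that for each $i$, $M_{u_i}$ is a maximum 0-1 timed matching for $T_{u_i}$ and there is no 0-1 timed matching $M'_{u_i}$ for $T_{u_i}$ with $|M'_{u_i}|=|M_{u_i}|$ such that $|R_{M'_{u_i}}(e_{vu_i})|=0$ but $|R_{M_{u_i}}(e_{vu_i})|>0$. If the maximum feasible set $F_v$ for $T_v$ is nonempty, then $TM2[v]:=F_v\cup\bigcup_i M_{u_i}$ is a 0-1 timed matching for $T_v$ of maximum cardinality among all 0-1 timed matchings for $T_v$ that contain at least one edge incident on $v$.
   Context: A temporal graph has a finite node set and a finite edge set; each edge joins two distinct nodes (at most one per pair) and is associated with a nonempty list of time intervals $[s_1,f_1),\dots,[s_k,f_k)$ of integers with $0\le s_1<f_1<s_2<\dots<s_k<f_k\le\mathcal{T}$ ($\mathcal{T}$ the lifetime), existing at each integer timestep in one of them. A rooted temporal tree is a temporal graph whose underlying static graph (edge $\{u,v\}$ per temporal edge) is a tree with a designated root; $P(v)$ is the parent, $child(v)$ the children, $T_v$ the temporal subtree on $v$ and its descendants, and $e_{xy}$ the edge between $x$ and $y$. Two distinct edges overlap if they share an endpoint and exist at a common timestep; a 0-1 timed matching is a set of edges no two of which overlap. For $u_i\in child(v)$ and a 0-1 timed matching $M$ of $T_{u_i}$, the minimum removal set $R_M(e_{vu_i})$ is a minimum-cardinality subset of $M$ whose removal makes $\{e_{vu_i}\}\cup(M\setminus R_M(e_{vu_i}))$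 a 0-1 timed matching. Given the $M_{u_i}$, a maximum allowable set for $T_v$ is a maximum-cardinality set $A$ of edges from $v$ to its children such that $A\cup\bigcup_i M_{u_i}$ is a 0-1 timed matching for $T_v$; a maximum feasible set $F_v$ is a maximum allowable set $A$ such that $A\cup\{e_{vP(v)}\}$ is a 0-1 timed matching, if such exists (and $v$ is not the root), and otherwise an arbitrary maximum allowable set. -}

module Defs where

open import Data.Nat using (ℕ; suc; _≤_; _<_)
open import Data.Fin using (Fin; _≟_)
open import Data.Fin.Subset using (Subset; _∈_; _⊆_; _∪_; _─_; ⁅_⁆; ⋃; ∣_∣)
open import Data.List using (List; map; filter; allFin)
open import Data.Maybe using (Maybe; just; nothing)
import Data.Maybe.Properties as MP
open import Data.Product using (Σ; ∃; _×_; _,_)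
open import Data.Sum using (_⊎_)
open import Relation.Binary.PropositionalEquality using (_≡_; _≢_)
open import Relation.Nullary using (¬_; Dec)

-- The tree is given by parent pointers; the
-- edge e_{c P(c)} is identified with its child endpoint c (a non-root node),
-- and its interval is [ start c , finish c ).
record TemporalTree (N : ℕ) : Set where
  field
    parent   : Fin N → Maybe (Fin N)
    root     : Fin N
    root-has-no-parent : parent root ≡ nothing
    nonroot-has-parent : ∀ v → v ≢ root → ∃ λ p → parent v ≡ just p
    -- acyclicity: a rank strictly decreasing towards the parent
    rank     : Fin N → ℕ
    rank-dec : ∀ v p → parent v ≡ just p → rank p < rank v
    lifetime : ℕ
    start    : Fin N → ℕ
    finish   : Fin N → ℕ
    interval-ok : ∀ v → v ≢ root → start v < finish v × finish v ≤ lifetime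

module _ {N : ℕ} (G : TemporalTree N) where
  open TemporalTree G

  IsEdge : Fin N → Set
  IsEdge e = e ≢ root

  Incident : Fin N → Fin N → Set
  Incident e x = (x ≡ e) ⊎ (parent e ≡ just x)

  ExistsAt : Fin N → ℕ → Set
  ExistsAt e t = start e ≤ t × t < finish e

  Overlap : Fin N → Fin N → Set
  Overlap e d = e ≢ d × (∃ λ x → Incident e x × Incident d x)
                      × (∃ λ t → ExistsAt e t × ExistsAt d t)

  IsTimedMatching : Subset N → Set
  IsTimedMatching M = (∀ e → e ∈ M → IsEdge e)
                    × (∀ e d → e ∈ M → d ∈ M → ¬ Overlap e d)

  data Desc (v : Fin N) : Fin N → Set where
    here  : Desc v v
    there : ∀ {w x} → parent w ≡ just x → Desc v x → Desc v w

  InSubtree : Fin N → Fin N → Set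
  InSubtree v e = Desc v e × e ≢ v

  IsTimedMatchingFor : Fin N → Subset N → Set
  IsTimedMatchingFor v M = IsTimedMatching M × (∀ e → e ∈ M → InSubtree v e)

  IsMaximumTimedMatchingFor : Fin N → Subset N → Set
  IsMaximumTimedMatchingFor v M =
    IsTimedMatchingFor v M × (∀ M' → IsTimedMatchingFor v M' → ∣ M' ∣ ≤ ∣ M ∣)

  IsRemovalSet : Subset N → Fin N → Subset N → Set
  IsRemovalSet M e R = R ⊆ M × IsTimedMatching (⁅ e ⁆ ∪ (M ─ R))

  MinRemovalSize : Subset N → Fin N → ℕ → Set
  MinRemovalSize M e k =
    (∃ λ R → IsRemovalSet M e R × ∣ R ∣ ≡ k)
    × (∀ R → IsRemovalSet M e R → k ≤ ∣ R ∣)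

  IsChild : Fin N → Fin N → Set
  IsChild c v = parent c ≡ just v

  child? : ∀ v c → Dec (IsChild c v)
  child? v c = MP.≡-dec _≟_ (parent c) (just v)

  children : Fin N → List (Fin N)
  children v = filter (child? v) (allFin N)

  ChildUnion : Fin N → (Fin N → Subset N) → Subset N
  ChildUnion v M = ⋃ (map M (children v))

  IsAllowable : Fin N → (Fin N → Subset N) → Subset N → Set
  IsAllowable v M A = (∀ e → e ∈ A → IsChild e v)
                    × IsTimedMatchingFor v (A ∪ ChildUnion v M)

  IsMaxAllowable : Fin N → (Fin N → Subset N) → Subset N → Set
  IsMaxAllowable v M A =
    IsAllowable v M A × (∀ A' → IsAllowable v M A' → ∣ A' ∣ ≤ ∣ A ∣)

  CompatibleWithParent : Fin N → Subset N → Set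
  CompatibleWithParent v A = v ≢ root × IsTimedMatching (A ∪ ⁅ v ⁆)

  IsMaxFeasible : Fin N → (Fin N → Subset N) → Subset N → Set
  IsMaxFeasible v M F =
    IsMaxAllowable v M F
    × ((∃ λ A → IsMaxAllowable v M A × CompatibleWithParent v A)
       → CompatibleWithParent v F)

-- Let U be the union of the M_u. A 0-1 timed matching M′ for T_v splits into blocks,
-- one per child u: its edges inside T_u, at most |M_u| of them, and possibly e_{vu}.
-- The edges e_{vu} ∈ M′ compatible with M_u (those for which {e_{vu}} ∪ M_u is a timed
-- matching) form an allowable set B, so |B| ≤ |F_v|, and their blocks have at most
-- |{e_{vu}} ∪ M_u| edges. If e_{vu} ∈ M′ is not compatible, the rest of its block has
-- fewer than |M_u| edges: otherwise it would be a maximum matching of T_u needing no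
-- removal for e_{vu} while M_u needs one, which the hypothesis on M_u excludes.
-- Summing over the blocks, |M′| ≤ |B ∪ U| ≤ |F_v| + |U| = |F_v ∪ U|.

module Submission where

open import Defs
open import Data.Nat using (ℕ; zero; suc; _+_; _≤_; _<_; z≤n; s≤s)
open import Data.Nat.Properties
  using ( ≤-refl; ≤-trans; ≤-reflexive; <-irrefl; <-≤-trans; <⇒≤; ≮⇒≥; ≤∧≢⇒<; +-suc; n≤1+n; n≮0
        ; +-monoʳ-≤; +-monoˡ-≤; +-mono-≤; _≤?_; +-0-commutativeMonoid; module ≤-Reasoning)
open import Data.Nat.Induction using (<-rec)
open import Data.Fin using (Fin; zero; suc; _≟_)
open import Data.Fin.Subset
open import Data.Fin.Subset.Properties
open import Data.Vec using ([]; _∷_; tabulate; here; there)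
open import Data.Vec.Properties using ([]=⇒lookup; lookup⇒[]=; lookup∘tabulate)
open import Data.List using (List; []; _∷_; map; allFin)
import Data.List.Membership.Propositional as List
open import Data.List.Membership.Propositional.Properties using (∈-filter⁻; ∈-filter⁺; ∈-allFin)
open import Data.List.Relation.Unary.Any using (here; there)
open import Data.Product using (Σ; ∃; _×_; _,_; proj₁; proj₂)
open import Data.Sum using (_⊎_; inj₁; inj₂)
open import Function using (_∘_)
open import Level using (Level; 0ℓ)
open import Relation.Binary.PropositionalEquality
open import Relation.Nullary using (¬_; yes; no; does; contradiction)
open import Relation.Nullary.Decidable using (dec-true; decidable-stable; ¬¬-excluded-middle)
open import Relation.Nullary.Negation using (¬¬-map)
open import Relation.Unary using (Pred; Decidable)
open import Algebra.Properties.CommutativeMonoid.Sum +-0-commutativeMonoid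
  using (sum; sum-syntax; ∑-distrib-+; sum-cong-≗; sum-replicate-zero)

private variable
  ℓ : Level
  n k : ℕ

x∈p─q⁻ : ∀ (p q : Subset n) {x} → x ∈ p ─ q → x ∈ p × x ∉ q
x∈p─q⁻ (inside ∷ p) (outside ∷ q) here = here , λ ()
x∈p─q⁻ (inside ∷ p) (inside ∷ q) {zero} ()
x∈p─q⁻ (outside ∷ p) (inside ∷ q) {zero} ()
x∈p─q⁻ (outside ∷ p) (outside ∷ q) {zero} ()
x∈p─q⁻ (_ ∷ p) (_ ∷ q) (there x∈p─q) with x∈p─q⁻ p q x∈p─q
... | x∈p , x∉q = there x∈p , λ { (there x∈q) → x∉q x∈q }

∣p∪q∣≤∣p∣+∣q∣ : ∀ (p q : Subset n) → ∣ p ∪ q ∣ ≤ ∣ p ∣ + ∣ q ∣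
∣p∪q∣≤∣p∣+∣q∣ [] [] = z≤n
∣p∪q∣≤∣p∣+∣q∣ (inside ∷ p) (inside ∷ q) =
  s≤s (≤-trans (∣p∪q∣≤∣p∣+∣q∣ p q) (+-monoʳ-≤ ∣ p ∣ (n≤1+n _)))
∣p∪q∣≤∣p∣+∣q∣ (inside ∷ p) (outside ∷ q) = s≤s (∣p∪q∣≤∣p∣+∣q∣ p q)
∣p∪q∣≤∣p∣+∣q∣ (outside ∷ p) (inside ∷ q) =
  ≤-trans (s≤s (∣p∪q∣≤∣p∣+∣q∣ p q)) (≤-reflexive (sym (+-suc _ _)))
∣p∪q∣≤∣p∣+∣q∣ (outside ∷ p) (outside ∷ q) = ∣p∪q∣≤∣p∣+∣q∣ p q

Empty-drop : ∀ {x} {p : Subset n} → Empty (x ∷ p) → Empty p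
Empty-drop x∷p≡∅ (y , y∈p) = x∷p≡∅ (suc y , there y∈p)

∩-Empty⇒∣p∪q∣≡∣p∣+∣q∣ : ∀ (p q : Subset n) → Empty (p ∩ q) → ∣ p ∪ q ∣ ≡ ∣ p ∣ + ∣ q ∣
∩-Empty⇒∣p∪q∣≡∣p∣+∣q∣ [] [] _ = refl
∩-Empty⇒∣p∪q∣≡∣p∣+∣q∣ (inside ∷ p) (inside ∷ q) p∩q≡∅ = contradiction (zero , here) p∩q≡∅
∩-Empty⇒∣p∪q∣≡∣p∣+∣q∣ (inside ∷ p) (outside ∷ q) p∩q≡∅ =
  cong suc (∩-Empty⇒∣p∪q∣≡∣p∣+∣q∣ p q (Empty-drop p∩q≡∅))
∩-Empty⇒∣p∪q∣≡∣p∣+∣q∣ (outside ∷ p) (inside ∷ q) p∩q≡∅ =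
  trans (cong suc (∩-Empty⇒∣p∪q∣≡∣p∣+∣q∣ p q (Empty-drop p∩q≡∅))) (sym (+-suc _ _))
∩-Empty⇒∣p∪q∣≡∣p∣+∣q∣ (outside ∷ p) (outside ∷ q) p∩q≡∅ =
  ∩-Empty⇒∣p∪q∣≡∣p∣+∣q∣ p q (Empty-drop p∩q≡∅)

∣p∣≤1+∣p-x∣ : ∀ (p : Subset n) x → ∣ p ∣ ≤ suc ∣ p - x ∣
∣p∣≤1+∣p-x∣ p x = begin
  ∣ p ∣                 ≤⟨ p⊆q⇒∣p∣≤∣q∣ p⊆⁅x⁆∪p-x ⟩
  ∣ ⁅ x ⁆ ∪ (p - x) ∣    ≤⟨ ∣p∪q∣≤∣p∣+∣q∣ ⁅ x ⁆ (p - x) ⟩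
  ∣ ⁅ x ⁆ ∣ + ∣ p - x ∣  ≡⟨ cong (_+ ∣ p - x ∣) (∣⁅x⁆∣≡1 x) ⟩
  suc ∣ p - x ∣          ∎
  where
  open ≤-Reasoning
  p⊆⁅x⁆∪p-x : p ⊆ ⁅ x ⁆ ∪ (p - x)
  p⊆⁅x⁆∪p-x {y} y∈p with y ≟ x
  ... | yes refl = x∈p∪q⁺ (inj₁ (x∈⁅x⁆ x))
  ... | no y≢x = x∈p∪q⁺ (inj₂ (x∈p∧x≢y⇒x∈p-y y∈p y≢x))

∣p∣≡0⇒x∉p : ∀ {p : Subset n} {x} → ∣ p ∣ ≡ 0 → x ∉ p
∣p∣≡0⇒x∉p {p = p} {x} ∣p∣≡0 x∈p = n≮0 (subst (∣ p - x ∣ <_) ∣p∣≡0 (x∈p⇒∣p-x∣<∣p∣ x∈p))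

x∈⋃map⁻ : ∀ (f : Fin k → Subset n) (ys : List (Fin k)) {x} →
  x ∈ ⋃ (map f ys) → ∃ λ y → y List.∈ ys × x ∈ f y
x∈⋃map⁻ f [] x∈ = contradiction x∈ ∉⊥
x∈⋃map⁻ f (y ∷ ys) x∈ with x∈p∪q⁻ (f y) (⋃ (map f ys)) x∈
... | inj₁ x∈fy = y , here refl , x∈fy
... | inj₂ x∈⋃ with x∈⋃map⁻ f ys x∈⋃
...   | z , z∈ys , x∈fz = z , there z∈ys , x∈fz

x∈⋃map⁺ : ∀ (f : Fin k → Subset n) (ys : List (Fin k)) {x y} →
  y List.∈ ys → x ∈ f y → x ∈ ⋃ (map f ys)
x∈⋃map⁺ f (_ ∷ ys) (here refl) x∈fy = x∈p∪q⁺ (inj₁ x∈fy)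
x∈⋃map⁺ f (_ ∷ ys) (there y∈ys) x∈fy = x∈p∪q⁺ (inj₂ (x∈⋃map⁺ f ys y∈ys x∈fy))

toSubset : {P : Pred (Fin n) ℓ} → Decidable P → Subset n
toSubset P? = tabulate (does ∘ P?)

x∈toSubset⁺ : ∀ {P : Pred (Fin n) ℓ} (P? : Decidable P) {x} → P x → x ∈ toSubset P?
x∈toSubset⁺ P? {x} Px = lookup⇒[]= x _ (trans (lookup∘tabulate (does ∘ P?) x) (dec-true (P? x) Px))

x∈toSubset⁻ : ∀ {P : Pred (Fin n) ℓ} (P? : Decidable P) {x} → x ∈ toSubset P? → P x
x∈toSubset⁻ P? {x} x∈ with P? x | trans (sym (lookup∘tabulate (does ∘ P?) x)) ([]=⇒lookup x∈)
... | yes Px | _ = Px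
... | no _ | ()

fibre : (Fin n → Fin k) → Fin k → Subset n
fibre f y = toSubset (λ x → f x ≟ y)

x∈fibre⁺ : ∀ (f : Fin n → Fin k) {x y} → f x ≡ y → x ∈ fibre f y
x∈fibre⁺ f = x∈toSubset⁺ (λ x → f x ≟ _)

x∈fibre⁻ : ∀ (f : Fin n → Fin k) {x y} → x ∈ fibre f y → f x ≡ y
x∈fibre⁻ f = x∈toSubset⁻ (λ x → f x ≟ _)

∑-indicator : (i : Fin k) → ∑[ y < k ] ∣ does (i ≟ y) ∷ [] ∣ ≡ 1
∑-indicator {suc k} zero = cong suc (sum-replicate-zero k)
∑-indicator {suc k} (suc i) = ∑-indicator i

∑-mono-≤ : ∀ (f g : Fin k → ℕ) → (∀ y → f y ≤ g y) → ∑[ y < k ] f y ≤ ∑[ y < k ] g y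
∑-mono-≤ {zero} f g f≤g = z≤n
∑-mono-≤ {suc k} f g f≤g = +-mono-≤ (f≤g zero) (∑-mono-≤ (f ∘ suc) (g ∘ suc) (f≤g ∘ suc))

∣p∣≡∑∣p∩fibre∣ : ∀ (f : Fin n → Fin k) p → ∣ p ∣ ≡ ∑[ y < k ] ∣ p ∩ fibre f y ∣
∣p∣≡∑∣p∩fibre∣ {k = k} f [] = sym (sum-replicate-zero k)
∣p∣≡∑∣p∩fibre∣ f (outside ∷ p) = ∣p∣≡∑∣p∩fibre∣ (f ∘ suc) p
∣p∣≡∑∣p∩fibre∣ {k = k} f (inside ∷ p) = begin
  suc ∣ p ∣
    ≡⟨ cong₂ _+_ (sym (∑-indicator (f zero))) (∣p∣≡∑∣p∩fibre∣ (f ∘ suc) p) ⟩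
  ∑[ y < k ] ∣ δ y ∷ [] ∣ + ∑[ y < k ] ∣ p ∩ fibre′ y ∣
    ≡⟨ ∑-distrib-+ (λ y → ∣ δ y ∷ [] ∣) (λ y → ∣ p ∩ fibre′ y ∣) ⟨
  ∑[ y < k ] (∣ δ y ∷ [] ∣ + ∣ p ∩ fibre′ y ∣)
    ≡⟨ sum-cong-≗ (λ y → ∣x∷[]∣+∣q∣≡∣x∷q∣ (δ y) (p ∩ fibre′ y)) ⟩
  ∑[ y < k ] ∣ δ y ∷ p ∩ fibre′ y ∣
    ∎
  where
  open ≡-Reasoning
  δ : Fin k → Side
  δ y = does (f zero ≟ y)
  fibre′ : Fin k → Subset _
  fibre′ = fibre (f ∘ suc)
  ∣x∷[]∣+∣q∣≡∣x∷q∣ : ∀ x (q : Subset n) → ∣ x ∷ [] ∣ + ∣ q ∣ ≡ ∣ x ∷ q ∣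
  ∣x∷[]∣+∣q∣≡∣x∷q∣ inside q = refl
  ∣x∷[]∣+∣q∣≡∣x∷q∣ outside q = refl

fibrewise-∣∣-mono : ∀ (f : Fin n → Fin k) p q →
  (∀ y → ∣ p ∩ fibre f y ∣ ≤ ∣ q ∩ fibre f y ∣) → ∣ p ∣ ≤ ∣ q ∣
fibrewise-∣∣-mono {k = k} f p q p≤q = begin
  ∣ p ∣                        ≡⟨ ∣p∣≡∑∣p∩fibre∣ f p ⟩
  ∑[ y < k ] ∣ p ∩ fibre f y ∣  ≤⟨ ∑-mono-≤ _ _ p≤q ⟩
  ∑[ y < k ] ∣ q ∩ fibre f y ∣  ≡⟨ ∣p∣≡∑∣p∩fibre∣ f q ⟨
  ∣ q ∣                        ∎
  where open ≤-Reasoning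

¬¬-decidable : (P : Pred (Fin n) ℓ) → ¬ ¬ Decidable P
¬¬-decidable {zero} P k = k (λ ())
¬¬-decidable {suc n} P k =
  ¬¬-excluded-middle λ P₀? → ¬¬-decidable (P ∘ suc) λ Pₛ? →
  k λ { zero → P₀? ; (suc x) → Pₛ? x }

¬¬-least : (Q : Pred ℕ ℓ) → Q n → ¬ ¬ (∃ λ m → Q m × ∀ j → Q j → m ≤ j)
¬¬-least {n = n} Q Qn no-least = <-rec (λ m → ¬ Q m) not-Q n Qn
  where
  not-Q : ∀ m → (∀ {j} → j < m → ¬ Q j) → ¬ Q m
  not-Q m ¬Q-below Qm = no-least (m , Qm , λ j Qj → ≮⇒≥ (λ j<m → ¬Q-below j<m Qj))

module _ {N : ℕ} (G : TemporalTree N) where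
  open TemporalTree G

  private variable
    a b e d u v w w′ x y : Fin N
    p q : Subset N

  Desc⇒rank≤ : Desc G a b → rank a ≤ rank b
  Desc⇒rank≤ here = ≤-refl
  Desc⇒rank≤ (there pb d) = ≤-trans (Desc⇒rank≤ d) (<⇒≤ (rank-dec _ _ pb))

  Desc-trans : Desc G a b → Desc G b x → Desc G a x
  Desc-trans d here = d
  Desc-trans d (there p e) = there p (Desc-trans d e)

  Desc-comparable : Desc G a y → Desc G b y → Desc G a b ⊎ Desc G b a
  Desc-comparable here d = inj₂ d
  Desc-comparable (there p d) here = inj₁ (there p d)
  Desc-comparable (there p d) (there q e) with trans (sym p) q
  ... | refl = Desc-comparable d e

  child-¬Desc-parent : IsChild G w v → ¬ Desc G w v
  child-¬Desc-parent {w} {v} cw d = <-irrefl refl (<-≤-trans (rank-dec w v cw) (Desc⇒rank≤ d))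

  child⇒IsEdge : IsChild G u v → IsEdge G u
  child⇒IsEdge cu refl with trans (sym root-has-no-parent) cu
  ... | ()

  children-disjoint : IsChild G w v → IsChild G w′ v → Desc G w y → Desc G w′ y → w ≡ w′
  children-disjoint cw cw′ d d′ with Desc-comparable d d′
  ... | inj₁ here = refl
  ... | inj₂ here = refl
  ... | inj₁ (there p e) with trans (sym p) cw′
  ...   | refl = contradiction e (child-¬Desc-parent cw)
  children-disjoint cw cw′ d d′ | inj₂ (there p e) with trans (sym p) cw
  ...   | refl = contradiction e (child-¬Desc-parent cw′)

  child-InSubtree : IsChild G u v → Desc G u x → InSubtree G v x
  child-InSubtree cu du = Desc-trans (there cu here) du , λ { refl → child-¬Desc-parent cu du }

  InSubtree-endpoint : InSubtree G w e → Incident G e y → Desc G w y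
  InSubtree-endpoint (de , _) (inj₁ refl) = de
  InSubtree-endpoint (here , e≢w) (inj₂ _) = contradiction refl e≢w
  InSubtree-endpoint (there p d , _) (inj₂ q) with trans (sym p) q
  ... | refl = d

  proper-Desc⇒child-Desc : Desc G v x → x ≢ v → ∃ λ u → IsChild G u v × Desc G u x
  proper-Desc⇒child-Desc here x≢v = contradiction refl x≢v
  proper-Desc⇒child-Desc {v} (there {x} {y} p d) _ with y ≟ v
  ... | yes refl = x , p , here
  ... | no y≢v with proper-Desc⇒child-Desc d y≢v
  ...   | u , cu , du = u , cu , there p du

  Overlap-sym : Overlap G e d → Overlap G d e
  Overlap-sym (e≢d , (x , ie , id) , (t , et , dt)) =
    (λ d≡e → e≢d (sym d≡e)) , (x , id , ie) , (t , dt , et)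

  IsTimedMatching-⊆ : p ⊆ q → IsTimedMatching G q → IsTimedMatching G p
  IsTimedMatching-⊆ p⊆q (edge , disjoint) =
    (λ e e∈p → edge e (p⊆q e∈p)) , (λ e d e∈p d∈p → disjoint e d (p⊆q e∈p) (p⊆q d∈p))

  ⁅⁆-IsTimedMatching : IsEdge G e → IsTimedMatching G ⁅ e ⁆
  ⁅⁆-IsTimedMatching {e} e-edge =
    (λ x x∈ → subst (IsEdge G) (sym (x∈⁅y⁆⇒x≡y e x∈)) e-edge) ,
    (λ x y x∈ y∈ (x≢y , _) → x≢y (trans (x∈⁅y⁆⇒x≡y e x∈) (sym (x∈⁅y⁆⇒x≡y e y∈))))

  ∪-IsTimedMatching : IsTimedMatching G p → IsTimedMatching G q →
    (∀ e d → e ∈ p → d ∈ q → ¬ Overlap G e d) → IsTimedMatching G (p ∪ q)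
  ∪-IsTimedMatching {p} {q} (p-edge , p-disjoint) (q-edge , q-disjoint) cross = edge , disjoint
    where
    edge : ∀ e → e ∈ p ∪ q → IsEdge G e
    edge e e∈ with x∈p∪q⁻ p q e∈
    ... | inj₁ e∈p = p-edge e e∈p
    ... | inj₂ e∈q = q-edge e e∈q
    disjoint : ∀ e d → e ∈ p ∪ q → d ∈ p ∪ q → ¬ Overlap G e d
    disjoint e d e∈ d∈ with x∈p∪q⁻ p q e∈ | x∈p∪q⁻ p q d∈
    ... | inj₁ e∈p | inj₁ d∈p = p-disjoint e d e∈p d∈p
    ... | inj₁ e∈p | inj₂ d∈q = cross e d e∈p d∈q
    ... | inj₂ e∈q | inj₁ d∈p = cross d e d∈p e∈q ∘ Overlap-sym
    ... | inj₂ e∈q | inj₂ d∈q = q-disjoint e d e∈q d∈q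

  ChildUnion⁻ : ∀ M → x ∈ ChildUnion G v M → ∃ λ u → IsChild G u v × x ∈ M u
  ChildUnion⁻ {v = v} M x∈ with x∈⋃map⁻ M (children G v) x∈
  ... | u , u∈ , x∈Mu = u , proj₂ (∈-filter⁻ (child? G v) {xs = allFin N} u∈) , x∈Mu

  ChildUnion⁺ : ∀ M → IsChild G u v → x ∈ M u → x ∈ ChildUnion G v M
  ChildUnion⁺ {v = v} M cu = x∈⋃map⁺ M (children G v) (∈-filter⁺ (child? G v) (∈-allFin _) cu)

  MinRemovalSize-0⁺ : IsTimedMatching G (⁅ e ⁆ ∪ p) → MinRemovalSize G p e 0
  MinRemovalSize-0⁺ {e} {p} matching =
    (⊥ , (⊥⊆ , subst (λ q → IsTimedMatching G (⁅ e ⁆ ∪ q)) (sym (p─⊥≡p p)) matching) , ∣⊥∣≡0 N) ,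
    (λ _ _ → z≤n)

  MinRemovalSize-0⁻ : MinRemovalSize G p e 0 → IsTimedMatching G (⁅ e ⁆ ∪ p)
  MinRemovalSize-0⁻ {p} {e} ((R , (_ , matching) , ∣R∣≡0) , _) =
    IsTimedMatching-⊆ ⊆-without-R matching
    where
    ⊆-without-R : ⁅ e ⁆ ∪ p ⊆ ⁅ e ⁆ ∪ (p ─ R)
    ⊆-without-R x∈ with x∈p∪q⁻ ⁅ e ⁆ p x∈
    ... | inj₁ x∈e = x∈p∪q⁺ (inj₁ x∈e)
    ... | inj₂ x∈p = x∈p∪q⁺ (inj₂ (x∈p∧x∉q⇒x∈p─q x∈p (∣p∣≡0⇒x∉p ∣R∣≡0)))

  self-IsRemovalSet : IsEdge G e → IsRemovalSet G p e p
  self-IsRemovalSet {e} {p} e-edge = ⊆-refl , IsTimedMatching-⊆ ⊆-⁅e⁆ (⁅⁆-IsTimedMatching e-edge)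
    where
    ⊆-⁅e⁆ : ⁅ e ⁆ ∪ (p ─ p) ⊆ ⁅ e ⁆
    ⊆-⁅e⁆ x∈ with x∈p∪q⁻ ⁅ e ⁆ (p ─ p) x∈
    ... | inj₁ x∈e = x∈e
    ... | inj₂ x∈p─p with x∈p─q⁻ p p x∈p─p
    ...   | x∈p , x∉p = contradiction x∈p x∉p

  ¬¬-MinRemovalSize : IsEdge G e → ¬ ¬ (∃ λ k → MinRemovalSize G p e k)
  ¬¬-MinRemovalSize {e} {p} e-edge =
    ¬¬-map minimum (¬¬-least RemovalSize (p , self-IsRemovalSet e-edge , refl))
    where
    RemovalSize : ℕ → Set
    RemovalSize k = ∃ λ R → IsRemovalSet G p e R × ∣ R ∣ ≡ k
    minimum : (∃ λ m → RemovalSize m × ∀ j → RemovalSize j → m ≤ j) →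
              ∃ λ k → MinRemovalSize G p e k
    minimum (m , R , least) = m , R , λ R′ removal → least ∣ R′ ∣ (R′ , removal , refl)

module ChildMatchings {N : ℕ} (G : TemporalTree N) (v : Fin N) (M : Fin N → Subset N)
  (M-maximum : ∀ u → IsChild G u v → IsMaximumTimedMatchingFor G u (M u))
  (M-preferred : ∀ u → IsChild G u v →
    ¬ (Σ (Subset N) λ M′ → IsTimedMatchingFor G u M′ × ∣ M′ ∣ ≡ ∣ M u ∣
         × MinRemovalSize G M′ u 0
         × (∃ λ k → MinRemovalSize G (M u) u (suc k))))
  where

  private variable
    e d u w x : Fin N
    A : Subset N

  U : Subset N
  U = ChildUnion G v M

  Compatible : Pred (Fin N) 0ℓ
  Compatible u = IsChild G u v × IsTimedMatching G (⁅ u ⁆ ∪ M u)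

  M-InSubtree : IsChild G u v → x ∈ M u → InSubtree G u x
  M-InSubtree cu x∈ = proj₂ (proj₁ (M-maximum _ cu)) _ x∈

  M-endpoint : IsChild G u v → x ∈ M u → Incident G x w → Desc G u w
  M-endpoint cu x∈ = InSubtree-endpoint G (M-InSubtree cu x∈)

  U-IsTimedMatchingFor : IsTimedMatchingFor G v U
  U-IsTimedMatchingFor = (edge , disjoint) , sub
    where
    edge : ∀ e → e ∈ U → IsEdge G e
    edge e e∈ with ChildUnion⁻ G M e∈
    ... | u , cu , e∈Mu = proj₁ (proj₁ (proj₁ (M-maximum u cu))) e e∈Mu
    sub : ∀ e → e ∈ U → InSubtree G v e
    sub e e∈ with ChildUnion⁻ G M e∈
    ... | u , cu , e∈Mu = child-InSubtree G cu (proj₁ (M-InSubtree cu e∈Mu))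
    disjoint : ∀ e d → e ∈ U → d ∈ U → ¬ Overlap G e d
    disjoint e d e∈ d∈ with ChildUnion⁻ G M e∈ | ChildUnion⁻ G M d∈
    ... | u , cu , e∈Mu | w , cw , d∈Mw with u ≟ w
    ...   | yes refl = proj₂ (proj₁ (proj₁ (M-maximum u cu))) e d e∈Mu d∈Mw
    ...   | no u≢w = λ (_ , (y , ey , dy) , _) →
              u≢w (children-disjoint G cu cw (M-endpoint cu e∈Mu ey) (M-endpoint cw d∈Mw dy))

  compatible-¬Overlap : Compatible e → IsChild G w v → d ∈ M w → ¬ Overlap G e d
  compatible-¬Overlap {e} {w} {d} (ce , e∪Me) cw d∈Mw with w ≟ e
  ... | yes refl = proj₂ e∪Me e d (x∈p∪q⁺ (inj₁ (x∈⁅x⁆ e))) (x∈p∪q⁺ (inj₂ d∈Mw))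
  ... | no w≢e = λ (_ , (y , ey , dy) , _) → shared-endpoint y ey (M-endpoint cw d∈Mw dy)
    where
    shared-endpoint : ∀ y → Incident G e y → ¬ Desc G w y
    shared-endpoint y (inj₁ refl) dwy = w≢e (children-disjoint G cw ce dwy here)
    shared-endpoint y (inj₂ py) dwy with trans (sym ce) py
    ... | refl = child-¬Desc-parent G cw dwy

  compatible-IsAllowable : (∀ e → e ∈ A → Compatible e) → IsTimedMatching G A → IsAllowable G v M A
  compatible-IsAllowable {A} compatible A-matching =
    (λ e e∈ → proj₁ (compatible e e∈)) ,
    ∪-IsTimedMatching G A-matching (proj₁ U-IsTimedMatchingFor) cross , sub
    where
    cross : ∀ e d → e ∈ A → d ∈ U → ¬ Overlap G e d
    cross e d e∈ d∈ with ChildUnion⁻ G M d∈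
    ... | w , cw , d∈Mw = compatible-¬Overlap (compatible e e∈) cw d∈Mw
    sub : ∀ e → e ∈ A ∪ U → InSubtree G v e
    sub e e∈ with x∈p∪q⁻ A U e∈
    ... | inj₁ e∈A = child-InSubtree G (proj₁ (compatible e e∈A)) here
    ... | inj₂ e∈U = proj₂ U-IsTimedMatchingFor e e∈U

  incompatible⇒∣∣< : IsChild G u v → ¬ IsTimedMatching G (⁅ u ⁆ ∪ M u) →
    IsTimedMatchingFor G u A → IsTimedMatching G (⁅ u ⁆ ∪ A) → ∣ A ∣ < ∣ M u ∣
  incompatible⇒∣∣< {u} {A} cu incompatible A-matching u∪A-matching =
    ≤∧≢⇒< (proj₂ (M-maximum u cu) A A-matching) ∣A∣≢∣Mu∣
    where
    ∣A∣≢∣Mu∣ : ∣ A ∣ ≢ ∣ M u ∣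
    ∣A∣≢∣Mu∣ eq = ¬¬-MinRemovalSize G (child⇒IsEdge G cu) λ where
      (zero , min₀) → incompatible (MinRemovalSize-0⁻ G min₀)
      (suc k , min) → M-preferred u cu (A , A-matching , eq , MinRemovalSize-0⁺ G u∪A-matching , k , min)

  module _ (F : Subset N) (F-feasible : IsMaxFeasible G v M F) where

    F-child : e ∈ F → IsChild G e v
    F-child = proj₁ (proj₁ (proj₁ F-feasible)) _

    F∩U-Empty : Empty (F ∩ U)
    F∩U-Empty (x , x∈) with x∈p∩q⁻ F U x∈
    ... | x∈F , x∈U with ChildUnion⁻ G M x∈U
    ...   | w , cw , x∈Mw with M-InSubtree cw x∈Mw
    ...     | dwx , x≢w = x≢w (sym (children-disjoint G cw (F-child x∈F) dwx here))

    module _ (M′ : Subset N) (M′-matching : IsTimedMatchingFor G v M′)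
      (below? : Decidable λ x → ∃ λ u → IsChild G u v × Desc G u x)
      (compatible? : Decidable Compatible) where

      -- The fallback value is only taken outside T_v, where M′ has no edges.
      block : Fin N → Fin N
      block x with below? x
      ... | yes (u , _) = u
      ... | no _ = x

      block-child : InSubtree G v x → IsChild G (block x) v × Desc G (block x) x
      block-child {x} (dvx , x≢v) with below? x
      ... | yes (u , cu , du) = cu , du
      ... | no ¬below = contradiction (proper-Desc⇒child-Desc G dvx x≢v) ¬below

      block-unique : IsChild G u v → Desc G u x → block x ≡ u
      block-unique cu du with block-child (child-InSubtree G cu du)
      ... | c-block , d-block = children-disjoint G c-block cu d-block du

      B : Subset N
      B = M′ ∩ toSubset compatible?

      Z : Subset N
      Z = B ∪ U

      ∣B∣≤∣F∣ : ∣ B ∣ ≤ ∣ F ∣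
      ∣B∣≤∣F∣ = proj₂ (proj₁ F-feasible) B (compatible-IsAllowable compatible B-matching)
        where
        compatible : ∀ e → e ∈ B → Compatible e
        compatible e e∈ = x∈toSubset⁻ compatible? (proj₂ (x∈p∩q⁻ M′ _ e∈))
        B-matching : IsTimedMatching G B
        B-matching = IsTimedMatching-⊆ G (p∩q⊆p M′ _) (proj₁ M′-matching)

      module Block {u} (cu : IsChild G u v) where

        M′ᵤ : Subset N
        M′ᵤ = M′ ∩ fibre block u

        Zᵤ : Subset N
        Zᵤ = Z ∩ fibre block u

        M′ᵤ⁻ : x ∈ M′ᵤ → x ∈ M′ × Desc G u x
        M′ᵤ⁻ {x} x∈ with x∈p∩q⁻ M′ _ x∈
        ... | x∈M′ , x∈fibre = x∈M′ , subst (λ b → Desc G b x) (x∈fibre⁻ block x∈fibre)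
                                             (proj₂ (block-child (proj₂ M′-matching x x∈M′)))

        M′ᵤ-u⊆M′ : M′ᵤ - u ⊆ M′
        M′ᵤ-u⊆M′ x∈ = proj₁ (M′ᵤ⁻ (proj₁ (x∈p─q⁻ M′ᵤ ⁅ u ⁆ x∈)))

        M′ᵤ-u-IsTimedMatchingFor : IsTimedMatchingFor G u (M′ᵤ - u)
        M′ᵤ-u-IsTimedMatchingFor =
          IsTimedMatching-⊆ G M′ᵤ-u⊆M′ (proj₁ M′-matching) ,
          λ x x∈ → let x∈M′ᵤ , x∉u = x∈p─q⁻ M′ᵤ ⁅ u ⁆ x∈ in proj₂ (M′ᵤ⁻ x∈M′ᵤ) , x∉⁅y⁆⇒x≢y x∉u

        ∣M′ᵤ-u∣≤∣Mu∣ : ∣ M′ᵤ - u ∣ ≤ ∣ M u ∣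
        ∣M′ᵤ-u∣≤∣Mu∣ = proj₂ (M-maximum u cu) (M′ᵤ - u) M′ᵤ-u-IsTimedMatchingFor

        Mu⊆Zᵤ : M u ⊆ Zᵤ
        Mu⊆Zᵤ x∈ = x∈p∩q⁺ (x∈p∪q⁺ (inj₂ (ChildUnion⁺ G M cu x∈)) ,
                           x∈fibre⁺ block (block-unique cu (proj₁ (M-InSubtree cu x∈))))

        ∣Mu∣≤∣Zᵤ∣ : ∣ M u ∣ ≤ ∣ Zᵤ ∣
        ∣Mu∣≤∣Zᵤ∣ = p⊆q⇒∣p∣≤∣q∣ Mu⊆Zᵤ

        bound-∉ : u ∉ M′ → ∣ M′ᵤ ∣ ≤ ∣ Zᵤ ∣
        bound-∉ u∉M′ = begin
          ∣ M′ᵤ ∣      ≤⟨ p⊆q⇒∣p∣≤∣q∣ M′ᵤ⊆M′ᵤ-u ⟩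
          ∣ M′ᵤ - u ∣  ≤⟨ ∣M′ᵤ-u∣≤∣Mu∣ ⟩
          ∣ M u ∣      ≤⟨ ∣Mu∣≤∣Zᵤ∣ ⟩
          ∣ Zᵤ ∣       ∎
          where
          open ≤-Reasoning
          M′ᵤ⊆M′ᵤ-u : M′ᵤ ⊆ M′ᵤ - u
          M′ᵤ⊆M′ᵤ-u x∈ = x∈p∧x≢y⇒x∈p-y x∈ λ { refl → u∉M′ (proj₁ (M′ᵤ⁻ x∈)) }

        bound-compatible : u ∈ M′ → Compatible u → ∣ M′ᵤ ∣ ≤ ∣ Zᵤ ∣
        bound-compatible u∈M′ u-compatible = begin
          ∣ M′ᵤ ∣              ≤⟨ ∣p∣≤1+∣p-x∣ M′ᵤ u ⟩
          suc ∣ M′ᵤ - u ∣      ≤⟨ s≤s ∣M′ᵤ-u∣≤∣Mu∣ ⟩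
          suc ∣ M u ∣          ≡⟨ cong (_+ ∣ M u ∣) (∣⁅x⁆∣≡1 u) ⟨
          ∣ ⁅ u ⁆ ∣ + ∣ M u ∣  ≡⟨ ∩-Empty⇒∣p∪q∣≡∣p∣+∣q∣ ⁅ u ⁆ (M u) u∉Mu ⟨
          ∣ ⁅ u ⁆ ∪ M u ∣      ≤⟨ p⊆q⇒∣p∣≤∣q∣ u∪Mu⊆Zᵤ ⟩
          ∣ Zᵤ ∣               ∎
          where
          open ≤-Reasoning
          u∉Mu : Empty (⁅ u ⁆ ∩ M u)
          u∉Mu (x , x∈) with x∈p∩q⁻ ⁅ u ⁆ (M u) x∈
          ... | x∈u , x∈Mu = proj₂ (M-InSubtree cu x∈Mu) (x∈⁅y⁆⇒x≡y u x∈u)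
          u∈Zᵤ : u ∈ Zᵤ
          u∈Zᵤ = x∈p∩q⁺ (x∈p∪q⁺ (inj₁ (x∈p∩q⁺ (u∈M′ , x∈toSubset⁺ compatible? u-compatible))) ,
                         x∈fibre⁺ block (block-unique cu here))
          u∪Mu⊆Zᵤ : ⁅ u ⁆ ∪ M u ⊆ Zᵤ
          u∪Mu⊆Zᵤ x∈ with x∈p∪q⁻ ⁅ u ⁆ (M u) x∈
          ... | inj₁ x∈u = subst (_∈ Zᵤ) (sym (x∈⁅y⁆⇒x≡y u x∈u)) u∈Zᵤ
          ... | inj₂ x∈Mu = Mu⊆Zᵤ x∈Mu

        bound-incompatible : u ∈ M′ → ¬ Compatible u → ∣ M′ᵤ ∣ ≤ ∣ Zᵤ ∣
        bound-incompatible u∈M′ u-incompatible = begin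
          ∣ M′ᵤ ∣          ≤⟨ ∣p∣≤1+∣p-x∣ M′ᵤ u ⟩
          suc ∣ M′ᵤ - u ∣  ≤⟨ ∣M′ᵤ-u∣<∣Mu∣ ⟩
          ∣ M u ∣          ≤⟨ ∣Mu∣≤∣Zᵤ∣ ⟩
          ∣ Zᵤ ∣           ∎
          where
          open ≤-Reasoning
          u∪M′ᵤ-u⊆M′ : ⁅ u ⁆ ∪ (M′ᵤ - u) ⊆ M′
          u∪M′ᵤ-u⊆M′ x∈ with x∈p∪q⁻ ⁅ u ⁆ (M′ᵤ - u) x∈
          ... | inj₁ x∈u = subst (_∈ M′) (sym (x∈⁅y⁆⇒x≡y u x∈u)) u∈M′
          ... | inj₂ x∈M′ᵤ-u = M′ᵤ-u⊆M′ x∈M′ᵤ-u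
          ∣M′ᵤ-u∣<∣Mu∣ : ∣ M′ᵤ - u ∣ < ∣ M u ∣
          ∣M′ᵤ-u∣<∣Mu∣ = incompatible⇒∣∣< cu (λ u∪Mu → u-incompatible (cu , u∪Mu))
            M′ᵤ-u-IsTimedMatchingFor (IsTimedMatching-⊆ G u∪M′ᵤ-u⊆M′ (proj₁ M′-matching))

        bound : ∣ M′ᵤ ∣ ≤ ∣ Zᵤ ∣
        bound with u ∈? M′ | compatible? u
        ... | no u∉M′  | _                  = bound-∉ u∉M′
        ... | yes u∈M′ | yes u-compatible   = bound-compatible u∈M′ u-compatible
        ... | yes u∈M′ | no u-incompatible  = bound-incompatible u∈M′ u-incompatible

      block-bound : ∀ u → ∣ M′ ∩ fibre block u ∣ ≤ ∣ Z ∩ fibre block u ∣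
      block-bound u with child? G v u
      ... | yes cu = Block.bound cu
      ... | no ¬cu = p⊆q⇒∣p∣≤∣q∣ M′ᵤ⊆Zᵤ
        where
        M′ᵤ⊆Zᵤ : M′ ∩ fibre block u ⊆ Z ∩ fibre block u
        M′ᵤ⊆Zᵤ {x} x∈ with x∈p∩q⁻ M′ _ x∈
        ... | x∈M′ , x∈fibre =
          contradiction (subst (λ b → IsChild G b v) (x∈fibre⁻ block x∈fibre)
                               (proj₁ (block-child (proj₂ M′-matching x x∈M′)))) ¬cu

      ∣M′∣≤∣F∪U∣ : ∣ M′ ∣ ≤ ∣ F ∪ U ∣
      ∣M′∣≤∣F∪U∣ = begin
        ∣ M′ ∣           ≤⟨ fibrewise-∣∣-mono block M′ Z block-bound ⟩
        ∣ B ∪ U ∣        ≤⟨ ∣p∪q∣≤∣p∣+∣q∣ B U ⟩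
        ∣ B ∣ + ∣ U ∣    ≤⟨ +-monoˡ-≤ ∣ U ∣ ∣B∣≤∣F∣ ⟩
        ∣ F ∣ + ∣ U ∣    ≡⟨ ∩-Empty⇒∣p∪q∣≡∣p∣+∣q∣ F U F∩U-Empty ⟨
        ∣ F ∪ U ∣        ∎
        where open ≤-Reasoning

lemma2 : {N : ℕ} (G : TemporalTree N) (v : Fin N)
    → (∃ λ c → IsChild G c v)
    → (M : Fin N → Subset N)
    → (∀ u → IsChild G u v → IsMaximumTimedMatchingFor G u (M u))
    → (∀ u → IsChild G u v →
         ¬ (Σ (Subset N) λ M' → IsTimedMatchingFor G u M' × ∣ M' ∣ ≡ ∣ M u ∣
              × MinRemovalSize G M' u 0
              × (∃ λ k → MinRemovalSize G (M u) u (suc k))))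
    → (F : Subset N) → IsMaxFeasible G v M F → Nonempty F
    → IsTimedMatchingFor G v (F ∪ ChildUnion G v M)
      × (∃ λ e → e ∈ (F ∪ ChildUnion G v M) × Incident G e v)
      × (∀ M' → IsTimedMatchingFor G v M' → (∃ λ e → e ∈ M' × Incident G e v)
           → ∣ M' ∣ ≤ ∣ F ∪ ChildUnion G v M ∣)
-- The bound holds for every 0-1 timed matching of T_v.
lemma2 G v _ M M-maximum M-preferred F F-feasible (e , e∈F) =
  proj₂ (proj₁ (proj₁ F-feasible)) ,
  (e , x∈p∪q⁺ (inj₁ e∈F) , inj₂ (F-child F F-feasible e∈F)) ,
  -- The inequality is decidable, so the classical case distinctions behind below?
  -- and compatible? may be made under a double negation.
  λ M′ M′-matching _ → decidable-stable (∣ M′ ∣ ≤? ∣ F ∪ U ∣) λ M′-larger →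
    ¬¬-decidable (λ x → ∃ λ u → IsChild G u v × Desc G u x) λ below? →
    ¬¬-decidable Compatible λ compatible? →
    M′-larger (∣M′∣≤∣F∪U∣ F F-feasible M′ M′-matching below? compatible?)
  where open ChildMatchings G v M M-maximum M-preferred
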